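{- Let $r\ge 1$ and $k_1,\dots,k_r\ge 3$ be arbitrary integers. The disjoint union of cycles $\bigcup_{i=1}^{r} C_{k_i}$ is odd prime.
   Context: All graphs are finite and simple. An odd prime labeling of a graph $G$ with $N$ vertices is a bijection $\ell:V(G)\to\{1,3,5,\dots,2N-1\}$ such that $\gcd(\ell(u),\ell(v))=1$ for every edge $uv$ of $G$; $G$ is called odd prime if it has an odd prime labeling. $C_k$ denotes the cycle on $k$ vertices. The disjoint union of graphs has as vertex set and edge set the disjoint unions of the vertex sets and edge sets. -}

module Defs where

open import Data.Nat using (ℕ; zero; suc; _+_; _*_; _∸_)
open import Data.Nat.Coprimality using (Coprime)
open import Data.Fin using (Fin; toℕ; splitAt)
open import Data.Sum using (_⊎_; inj₁; inj₂)
open import Data.Product using (_×_; Σ)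
open import Data.Empty using (⊥)
open import Data.List using (List; []; _∷_)
open import Function.Bundles using (_⤖_; Bijection)
open import Relation.Binary.PropositionalEquality using (_≡_)

-- A finite graph on the vertex set Fin size, given by its (edge) adjacency
-- relation.  (Only the edge relation matters for prime labelings; the
-- concrete graphs below are simple: symmetric and loop-free.)
record Graph : Set₁ where
  field
    size : ℕ
    Adj  : Fin size → Fin size → Set
open Graph public

cycleStep : (k : ℕ) → Fin k → Fin k → Set
cycleStep k i j = (toℕ j ≡ suc (toℕ i)) ⊎ ((toℕ i ≡ k ∸ 1) × (toℕ j ≡ 0))

-- The cycle C_k on vertices 0,…,k-1 (meant for k ≥ 3).
C : ℕ → Graph
C k = record { size = k ; Adj = λ i j → cycleStep k i j ⊎ cycleStep k j i }

unionAdj : (G H : Graph) → Fin (size G + size H) → Fin (size G + size H) → Set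
unionAdj G H u v with splitAt (size G) u | splitAt (size G) v
... | inj₁ a | inj₁ b = Adj G a b
... | inj₂ a | inj₂ b = Adj H a b
... | inj₁ _ | inj₂ _ = ⊥
... | inj₂ _ | inj₁ _ = ⊥

_⊕_ : Graph → Graph → Graph
G ⊕ H = record { size = size G + size H ; Adj = unionAdj G H }

emptyGraph : Graph
emptyGraph = record { size = 0 ; Adj = λ _ _ → ⊥ }

⋃ : List Graph → Graph
⋃ []       = emptyGraph
⋃ (G ∷ Gs) = G ⊕ ⋃ Gs

odd : ℕ → ℕ
odd i = 2 * i + 1

-- An odd prime labeling: a bijection V(G) → {1,3,…,2N-1}, encoded as a
-- bijection σ : Fin N ⤖ Fin N with ℓ(v) = 2·σ(v)+1, such that adjacent
-- vertices receive coprime labels.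
record OddPrimeLabeling (G : Graph) : Set where
  field
    σ       : Fin (size G) ⤖ Fin (size G)
    coprime : ∀ u v → Adj G u v →
              Coprime (odd (toℕ (Bijection.to σ u))) (odd (toℕ (Bijection.to σ v)))

IsOddPrime : Graph → Set
IsOddPrime G = OddPrimeLabeling G

-- Number each cycle C_k so that, going round it, the vertices receive
-- 0, 2, 4, … up to the largest even number below k, then the odd numbers
-- downwards …, 5, 3, 1.  Cyclically consecutive vertices then get numbers
-- differing by 1 or 2, and shifting the numbering of a cycle by the number
-- of vertices placed before it keeps this property, so the whole union is
-- numbered by 0, …, N-1 with adjacent vertices differing by 1 or 2.  The
-- labels ℓ = 2·number + 1 of adjacent vertices are then odd numbers
-- differing by 2 or 4, hence coprime.
module Submission where

open import Defs
open import Data.Nat using (ℕ; _≤_; suc)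
open import Data.List using (List; map; length)
open import Data.List.Relation.Unary.All using (All)

open import Data.Nat using (_+_; _*_; _∸_; _<_; s≤s; _≤?_)
open import Data.Nat.Properties
  using ( +-suc; +-comm; *-suc; +-identityʳ; suc-injective; +-cancelˡ-≡; +-cancelʳ-≡; *-cancelˡ-≡
        ; even≢odd; n∸n≡0; m+[n∸m]≡n; ≤-trans; ≤-antisym; n≤1+n; n<1+n; 1+n≰n; ≰⇒>
        ; m≤n⇒m<n∨m≡n; +-monoʳ-≤; +-monoˡ-≤; +-monoʳ-<; module ≤-Reasoning)
open import Data.Nat.Divisibility using (_∣_; ∣-trans; m∣m*n; ∣m+n∣m⇒∣n; ∣1⇒≡1)
open import Data.Nat.Coprimality as Coprime using (Coprime; coprime-factors)
open import Data.Fin using (Fin; toℕ; opposite; fromℕ<; punchOut; splitAt; _≟_)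
open import Data.Fin.Properties
  using (toℕ<n; toℕ-fromℕ<; toℕ-injective; opposite-prop; any?; injective⇒≤; punchOut-injective; +↔⊎; toℕ-↑ˡ; toℕ-↑ʳ)
open import Data.List using ([]; _∷_)
open import Data.List.Relation.Unary.All as All using ([]; _∷_)
open import Data.Sum using (inj₁; inj₂)
open import Data.Sum.Function.Propositional using (_⊎-⤖_)
open import Data.Product using (_,_)
open import Relation.Nullary using (yes; no; contradiction)
open import Relation.Binary.PropositionalEquality
open import Function.Bundles using (_⤖_; Bijection; mk⤖)
open import Function.Definitions using (Injective; StrictlySurjective)
open import Function.Consequences.Propositional using (strictlySurjective⇒surjective)
open import Function.Construct.Identity using (⤖-id)
open import Function.Construct.Composition using (_⤖-∘_)
open import Function.Properties.Inverse using (↔⇒⤖; ↔-sym)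

coprime-2-odd : ∀ a → Coprime 2 (odd a)
coprime-2-odd a (d∣2 , d∣odd) = ∣1⇒≡1 (∣m+n∣m⇒∣n d∣odd (∣-trans d∣2 (m∣m*n a)))

coprime-*ˡ : ∀ {m n o} → Coprime m n → Coprime o n → Coprime (m * o) n
coprime-*ˡ m⊥n o⊥n (d∣m*o , d∣n) = o⊥n (coprime-factors m⊥n (d∣m*o , ∣-trans d∣n (m∣m*n _)) , d∣n)

coprime-+ˡ : ∀ {m n} → Coprime m n → Coprime n (m + n)
coprime-+ˡ {m} {n} m⊥n {d} (d∣n , d∣m+n) = m⊥n (∣m+n∣m⇒∣n (subst (d ∣_) (+-comm m n) d∣m+n) d∣n , d∣n)

odd-suc : ∀ a → odd (suc a) ≡ 2 + odd a
odd-suc a = cong (_+ 1) (*-suc 2 a)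

injective⇒strictlySurjective : ∀ {n} {f : Fin n → Fin n} → Injective _≡_ _≡_ f → StrictlySurjective _≡_ f
injective⇒strictlySurjective {suc n} {f} f-inj y with any? (λ x → f x ≟ y)
... | yes fx≡y = fx≡y
... | no ∄x = contradiction (injective⇒≤ avoid-y-injective) 1+n≰n
  where
  fx≢y : ∀ x → y ≢ f x
  fx≢y x y≡fx = ∄x (x , sym y≡fx)
  avoid-y-injective : Injective _≡_ _≡_ (λ x → punchOut (fx≢y x))
  avoid-y-injective {x} {x′} eq = f-inj (punchOut-injective (fx≢y x) (fx≢y x′) eq)

injective⇒⤖ : ∀ {n} {f : Fin n → Fin n} → Injective _≡_ _≡_ f → Fin n ⤖ Fin n
injective⇒⤖ f-inj = mk⤖ (f-inj , strictlySurjective⇒surjective (injective⇒strictlySurjective f-inj))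

suc[toℕ+toℕ-opposite]≡n : ∀ {n} (u : Fin n) → suc (toℕ u + toℕ (opposite u)) ≡ n
suc[toℕ+toℕ-opposite]≡n {n} u = begin
  suc (toℕ u + toℕ (opposite u))   ≡⟨ cong (λ r → suc (toℕ u + r)) (opposite-prop u) ⟩
  suc (toℕ u + (n ∸ suc (toℕ u)))  ≡⟨ m+[n∸m]≡n (toℕ<n u) ⟩
  n                                ∎
  where open ≡-Reasoning

data Near : ℕ → ℕ → Set where
  gap₁ : ∀ a → Near a (1 + a)
  gap₂ : ∀ a → Near a (2 + a)
  swap : ∀ {a b} → Near a b → Near b a

near-+ : ∀ c {a b} → Near a b → Near (c + a) (c + b)
near-+ c (gap₁ a) = subst (Near (c + a)) (sym (+-suc c a)) (gap₁ (c + a))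
near-+ c (gap₂ a) = subst (Near (c + a)) (sym (trans (+-suc c (1 + a)) (cong suc (+-suc c a)))) (gap₂ (c + a))
near-+ c (swap n) = swap (near-+ c n)

near⇒coprime-odd : ∀ {a b} → Near a b → Coprime (odd a) (odd b)
near⇒coprime-odd (gap₁ a) = subst (Coprime (odd a)) (sym (odd-suc a)) (coprime-+ˡ (coprime-2-odd a))
near⇒coprime-odd (gap₂ a) =
  subst (Coprime (odd a)) (sym (trans (odd-suc (suc a)) (cong (2 +_) (odd-suc a))))
        (coprime-+ˡ (coprime-*ˡ (coprime-2-odd a) (coprime-2-odd a)))
near⇒coprime-odd (swap n) = Coprime.sym (near⇒coprime-odd n)

record NearLabeling (G : Graph) : Set where
  field
    σ    : Fin (size G) ⤖ Fin (size G)
    near : ∀ u v → Adj G u v → Near (toℕ (Bijection.to σ u)) (toℕ (Bijection.to σ v))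

nearLabeling⇒oddPrime : ∀ {G} → NearLabeling G → IsOddPrime G
nearLabeling⇒oddPrime ℓ = record
  { σ = σ ; coprime = λ u v uv → near⇒coprime-odd (near u v uv) }
  where open NearLabeling ℓ

emptyNearLabeling : NearLabeling emptyGraph
emptyNearLabeling = record { σ = ⤖-id _ ; near = λ _ _ () }

⊕-nearLabeling : ∀ {G H} → NearLabeling G → NearLabeling H → NearLabeling (G ⊕ H)
⊕-nearLabeling {G} {H} ℓ₁ ℓ₂ = record { σ = σ ; near = near }
  where
  module ℓ₁ = NearLabeling ℓ₁
  module ℓ₂ = NearLabeling ℓ₂
  m n : ℕ
  m = size G
  n = size H
  σ : Fin (m + n) ⤖ Fin (m + n)
  σ = ↔⇒⤖ (↔-sym +↔⊎) ⤖-∘ ((ℓ₁.σ ⊎-⤖ ℓ₂.σ) ⤖-∘ ↔⇒⤖ +↔⊎)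
  near : ∀ u v → unionAdj G H u v → Near (toℕ (Bijection.to σ u)) (toℕ (Bijection.to σ v))
  near u v uv with splitAt m u | splitAt m v
  ... | inj₁ x | inj₁ y =
    subst₂ Near (sym (toℕ-↑ˡ _ n)) (sym (toℕ-↑ˡ _ n)) (ℓ₁.near x y uv)
  ... | inj₂ x | inj₂ y =
    subst₂ Near (sym (toℕ-↑ʳ m _)) (sym (toℕ-↑ʳ m _)) (near-+ m (ℓ₂.near x y uv))

-- The number of the vertex with i vertices before it and r after it on a cycle
-- of length i + 1 + r: round the cycle these are 0, 2, 4, …, 5, 3, 1.
zigzag : ℕ → ℕ → ℕ
zigzag i r with i ≤? r
... | yes _ = 2 * i
... | no  _ = suc (2 * r)

2*n≡n+n : ∀ n → 2 * n ≡ n + n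
2*n≡n+n n = cong (n +_) (+-identityʳ n)

zigzag-< : ∀ i r → zigzag i r < i + suc r
zigzag-< i r with i ≤? r
... | yes i≤r = begin-strict
  2 * i   ≡⟨ 2*n≡n+n i ⟩
  i + i   ≤⟨ +-monoʳ-≤ i i≤r ⟩
  i + r   <⟨ +-monoʳ-< i (n<1+n r) ⟩
  i + suc r ∎
  where open ≤-Reasoning
... | no i≰r = begin-strict
  suc (2 * r)     ≡⟨ cong suc (2*n≡n+n r) ⟩
  suc (r + r)     <⟨ s≤s (+-monoʳ-< r (n<1+n r)) ⟩
  suc r + suc r   ≤⟨ +-monoˡ-≤ (suc r) (≰⇒> i≰r) ⟩
  i + suc r       ∎
  where open ≤-Reasoning

zigzag-injective : ∀ {i r j s} → i + r ≡ j + s → zigzag i r ≡ zigzag j s → i ≡ j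
zigzag-injective {i} {r} {j} {s} sum eq with i ≤? r | j ≤? s
... | yes _ | yes _ = *-cancelˡ-≡ i j 2 eq
... | yes _ | no  _ = contradiction eq (even≢odd i s)
... | no  _ | yes _ = contradiction (sym eq) (even≢odd j r)
... | no  _ | no  _ = +-cancelʳ-≡ r i j (trans sum (cong (j +_) (sym r≡s)))
  where
  r≡s : r ≡ s
  r≡s = *-cancelˡ-≡ r s 2 (suc-injective eq)

zigzag-step : ∀ i r → Near (zigzag i (suc r)) (zigzag (suc i) r)
zigzag-step i r with i ≤? suc r | suc i ≤? r
... | yes _ | yes _ = subst (Near (2 * i)) (sym (*-suc 2 i)) (gap₂ (2 * i))
... | no i≰1+r | yes 1+i≤r = contradiction (≤-trans (n≤1+n i) (≤-trans 1+i≤r (n≤1+n r))) i≰1+r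
... | no  _ | no  _ = subst (λ x → Near (suc x) (suc (2 * r))) (sym (*-suc 2 r)) (swap (gap₂ (suc (2 * r))))
... | yes i≤1+r | no 1+i≰r with m≤n⇒m<n∨m≡n i≤1+r | ≰⇒> 1+i≰r
...   | inj₁ (s≤s i≤r) | s≤s r≤i rewrite ≤-antisym i≤r r≤i = gap₁ (2 * r)
...   | inj₂ refl      | _ = subst (λ x → Near x (suc (2 * r))) (sym (*-suc 2 r)) (swap (gap₁ (suc (2 * r))))

zigzag-wrap : ∀ m r → Near (zigzag (suc m) 0) (zigzag 0 r)
zigzag-wrap m r = swap (gap₁ 0)

cycleLabel : ∀ {k} → Fin k → ℕ
cycleLabel u = zigzag (toℕ u) (toℕ (opposite u))

cycleLabel-< : ∀ {k} (u : Fin k) → cycleLabel u < k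
cycleLabel-< u = subst (cycleLabel u <_)
  (trans (+-suc (toℕ u) _) (suc[toℕ+toℕ-opposite]≡n u)) (zigzag-< (toℕ u) (toℕ (opposite u)))

cycleLabel-injective : ∀ {k} {u v : Fin k} → cycleLabel u ≡ cycleLabel v → u ≡ v
cycleLabel-injective {u = u} {v} eq = toℕ-injective (zigzag-injective
  (suc-injective (trans (suc[toℕ+toℕ-opposite]≡n u) (sym (suc[toℕ+toℕ-opposite]≡n v)))) eq)

cycleLabel-next : ∀ {k} (u v : Fin k) → toℕ v ≡ suc (toℕ u) → Near (cycleLabel u) (cycleLabel v)
cycleLabel-next u v v≡1+u =
  subst₂ (λ r j → Near (zigzag (toℕ u) r) (zigzag j (toℕ (opposite v))))
         (sym ou≡1+ov) (sym v≡1+u) (zigzag-step (toℕ u) (toℕ (opposite v)))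
  where
  ou≡1+ov : toℕ (opposite u) ≡ suc (toℕ (opposite v))
  ou≡1+ov = +-cancelˡ-≡ (toℕ u) _ _ (suc-injective (begin
    suc (toℕ u + toℕ (opposite u))        ≡⟨ suc[toℕ+toℕ-opposite]≡n u ⟩
    _                                      ≡⟨ suc[toℕ+toℕ-opposite]≡n v ⟨
    suc (toℕ v + toℕ (opposite v))        ≡⟨ cong (λ j → suc (j + toℕ (opposite v))) v≡1+u ⟩
    suc (suc (toℕ u) + toℕ (opposite v))  ≡⟨ cong suc (+-suc (toℕ u) _) ⟨
    suc (toℕ u + suc (toℕ (opposite v)))  ∎))
    where open ≡-Reasoning

cycleLabel-near : ∀ m (u v : Fin (2 + m)) → cycleStep (2 + m) u v → Near (cycleLabel u) (cycleLabel v)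
cycleLabel-near m u v (inj₁ v≡1+u) = cycleLabel-next u v v≡1+u
cycleLabel-near m u v (inj₂ (u≡1+m , v≡0)) =
  subst₂ Near (sym (cong₂ zigzag u≡1+m ou≡0)) (sym (cong (λ i → zigzag i (toℕ (opposite v))) v≡0))
         (zigzag-wrap m (toℕ (opposite v)))
  where
  ou≡0 : toℕ (opposite u) ≡ 0
  ou≡0 = trans (opposite-prop u) (trans (cong (λ i → 2 + m ∸ suc i) u≡1+m) (n∸n≡0 m))

cycleNearLabeling : ∀ k → 2 ≤ k → NearLabeling (C k)
cycleNearLabeling (suc (suc m)) (s≤s (s≤s _)) = record
  { σ = injective⇒⤖ label-injective
  ; near = λ u v uv → subst₂ Near (sym (toℕ-label u)) (sym (toℕ-label v)) (near u v uv)
  }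
  where
  label : Fin (2 + m) → Fin (2 + m)
  label u = fromℕ< (cycleLabel-< u)
  toℕ-label : ∀ u → toℕ (label u) ≡ cycleLabel u
  toℕ-label u = toℕ-fromℕ< (cycleLabel-< u)
  label-injective : Injective _≡_ _≡_ label
  label-injective {u} {v} eq =
    cycleLabel-injective (trans (sym (toℕ-label u)) (trans (cong toℕ eq) (toℕ-label v)))
  near : ∀ u v → Adj (C (2 + m)) u v → Near (cycleLabel u) (cycleLabel v)
  near u v (inj₁ uv) = cycleLabel-near m u v uv
  near u v (inj₂ vu) = swap (cycleLabel-near m v u vu)

⋃-cycles-nearLabeling : ∀ ks → All (2 ≤_) ks → NearLabeling (⋃ (map C ks))
⋃-cycles-nearLabeling []       []       = emptyNearLabeling
⋃-cycles-nearLabeling (k ∷ ks) (2≤k ∷ 2≤ks) =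
  ⊕-nearLabeling (cycleNearLabeling k 2≤k) (⋃-cycles-nearLabeling ks 2≤ks)

mainTheorem1 : (ks : List ℕ) → 1 ≤ length ks → All (λ k → 3 ≤ k) ks →
    IsOddPrime (⋃ (map C ks))
mainTheorem1 ks _ 3≤ks =
  nearLabeling⇒oddPrime (⋃-cycles-nearLabeling ks (All.map (≤-trans (n≤1+n 2)) 3≤ks))
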